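{- Let $G$ be a strongly connected digraph with $n\ge 3$ vertices and $m=2n-2$ arcs. Then $\mathrm{Rel}(S_n,p)\ge \mathrm{Rel}(G,p)$ for all $p\in[0,1]$, where $S_n$ is the digraph whose underlying graph is the star $K_{1,n-1}$ with every edge replaced by a bundle.
   Context: Digraphs are finite, without loops and without two arcs in the same direction between the same ordered pair of vertices. A bundle is a pair of antiparallel arcs $u\to v$, $v\to u$ between distinct vertices. Strongly connected node reliability: each vertex of a digraph $G$ is independently operational with probability $p\in[0,1]$, and $\mathrm{Rel}(G,p)$ is the probability that the set of operational vertices is nonempty and induces a strongly connected subdigraph (a single vertex counts as strongly connected).
   Formalization: The vertex probability $p$ ranges over the rational numbers in $[0,1]$. -}

module Defs where

open import Data.Nat using (ℕ; zero; suc; _∸_)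
open import Data.Bool using (Bool; true; false)
open import Data.Fin using (Fin; zero; suc)
open import Data.Fin.Subset using (Subset; _∈_; ⊤; ∣_∣; Nonempty)
open import Data.Vec using (_∷_; [])
open import Data.List using (List; []; _∷_; map; _++_; sum)
open import Data.Product using (_×_)
open import Relation.Nullary using (Dec; yes; no)
open import Relation.Binary.PropositionalEquality using (_≡_)
open import Data.Rational using (ℚ; 0ℚ; 1ℚ; _+_; _*_; _-_)

record Digraph (n : ℕ) : Set where
  field
    arc      : Fin n → Fin n → Bool
    loopless : ∀ i → arc i i ≡ false
open Digraph public

countFin : ∀ {n} → (Fin n → ℕ) → ℕ
countFin {zero}  f = 0
countFin {suc n} f = f zero Data.Nat.+ countFin (λ i → f (suc i))

b2n : Bool → ℕ
b2n true  = 1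
b2n false = 0

numArcs : ∀ {n} → Digraph n → ℕ
numArcs G = countFin (λ u → countFin (λ v → b2n (arc G u v)))

-- Directed walks inside a vertex subset S (all vertices after the start
-- must lie in S; the start is required to be in S by the caller).

data Reach {n : ℕ} (G : Digraph n) (S : Subset n) : Fin n → Fin n → Set where
  here : ∀ {u} → Reach G S u u
  step : ∀ {u v w} → arc G u v ≡ true → v ∈ S → Reach G S v w → Reach G S u w

StronglyConnectedOn : ∀ {n} → Digraph n → Subset n → Set
StronglyConnectedOn G S = ∀ u v → u ∈ S → v ∈ S → Reach G S u v

StronglyConnected : ∀ {n} → Digraph n → Set
StronglyConnected G = StronglyConnectedOn G ⊤

Good : ∀ {n} → Digraph n → Subset n → Set
Good G S = Nonempty S × StronglyConnectedOn G S

allSubsets : (n : ℕ) → List (Subset n)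
allSubsets zero    = [] ∷ []
allSubsets (suc n) = map (true ∷_) (allSubsets n) ++ map (false ∷_) (allSubsets n)

_^ℚ_ : ℚ → ℕ → ℚ
x ^ℚ zero  = 1ℚ
x ^ℚ suc k = x * (x ^ℚ k)

indicator : ∀ {A : Set} → Dec A → ℚ
indicator (yes _) = 1ℚ
indicator (no _)  = 0ℚ

-- The indicator uses a decision procedure for Good; any two decision
-- procedures for the same type give the same indicator value.
Rel : ∀ {n} (G : Digraph n) → (∀ S → Dec (Good G S)) → ℚ → ℚ
Rel {n} G dec p =
  sum' (map (λ S → indicator (dec S) * ((p ^ℚ ∣ S ∣) * ((1ℚ - p) ^ℚ (n ∸ ∣ S ∣)))) (allSubsets n))
  where
    sum' : List ℚ → ℚ
    sum' []       = 0ℚ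
    sum' (x ∷ xs) = x + sum' xs

-- The bidirected star S_n: vertex 0 is the centre, every other vertex is
-- joined to the centre by a bundle.

starArc : ∀ {n} → Fin n → Fin n → Bool
starArc zero    (suc _) = true
starArc (suc _) zero    = true
starArc _       _       = false

starLoopless : ∀ {n} (i : Fin n) → starArc i i ≡ false
starLoopless zero    = Relation.Binary.PropositionalEquality.refl
starLoopless (suc i) = Relation.Binary.PropositionalEquality.refl

star : (n : ℕ) → Digraph n
star n = record { arc = starArc ; loopless = starLoopless }

{-# OPTIONS --safe #-}
module Submission where

-- By induction on N we prove the
-- stronger q^d·Pr(S ∈ 𝓟) ≤ p + (N-1)·p·q^(N-1+d) for any family 𝓟 of good sets of a digraph with
-- fewer than 2(N+d) arcs. Counting degrees gives a vertex v of degree < 2(d+2); let A be the smaller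
-- of its in- and out-neighbourhoods, so s = |A| ≤ d+1. A good set containing v is either {v} or
-- meets A, and a good set avoiding v is good in G - v, which has fewer than 2(N-1+d') arcs for
-- d' = d+1-s. Conditioning on v and applying the induction hypothesis to G - v with slack d' yields
-- the bound up to the nonnegative term p(1-q^d)(1-q^s).

open import Defs
open import Data.Nat using (ℕ; _≤_; _∸_; _*_)
open import Data.Fin.Subset using (Subset)
open import Relation.Nullary using (Dec)
open import Relation.Binary.PropositionalEquality using (_≡_)
open import Data.Rational using (ℚ; 0ℚ; 1ℚ) renaming (_≤_ to _≤ℚ_)

open import Level using (0ℓ)
open import Data.Bool using (Bool; true; false; not; _∧_; T)
open import Data.Bool.Properties using (T-≡; T-∧)
open import Data.Empty using (⊥-elim)
open import Data.Unit using (tt)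
open import Data.Product using (∃; _×_; _,_; proj₂)
open import Data.Nat using (zero; suc; _<_; z≤n; s≤s; z<s)
import Data.Nat as ℕ
import Data.Nat.Properties as ℕₚ
import Data.Nat.Tactic.RingSolver as ℕ-Solver
open import Data.Rational using (_+_; _-_; -_; nonNegative) renaming (_*_ to _·_)
import Data.Rational.Properties as ℚₚ
open import Data.Fin using (Fin; zero; suc; punchIn; punchOut)
import Data.Fin.Properties as Finₚ
open import Data.Fin.Subset using (∣_∣; _∈_; Nonempty)
import Data.Fin.Subset.Properties as Subsetₚ
open import Data.Vec using ([]; _∷_; here; there; insertAt; lookup)
import Data.Vec.Properties as Vecₚ
open import Data.List using (List; []; _∷_; _++_; map; foldr)
import Data.List.Properties as Listₚ
open import Function.Bundles using (Equivalence)
open import Relation.Nullary using (¬_; yes; no)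
open import Relation.Nullary.Decidable using (dec⇒maybe; T?)
open import Relation.Unary using (Pred; Decidable; _⊆_)
open import Relation.Binary.PropositionalEquality
  using (_≢_; refl; sym; trans; cong; cong₂; subst; module ≡-Reasoning)
open import Tactic.RingSolver using (solve-∀)
open import Tactic.RingSolver.Core.AlmostCommutativeRing using (AlmostCommutativeRing; fromCommutativeRing)
open import Algebra.Properties.CommutativeMonoid.Sum ℕₚ.+-0-commutativeMonoid
  using (sum; sum-remove; sum-cong-≗; ∑-comm; ∑-distrib-+)
open import Algebra.Definitions.RawMonoid Data.Rational.+-0-rawMonoid using () renaming (_×_ to _×ℚ_)

ℚ-ring : AlmostCommutativeRing 0ℓ 0ℓ
ℚ-ring = fromCommutativeRing ℚₚ.+-*-commutativeRing (λ x → dec⇒maybe (0ℚ ℚₚ.≟ x))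

-- Rational inequalities

0≤1 : 0ℚ ≤ℚ 1ℚ
0≤1 = ℚₚ.nonNegative⁻¹ 1ℚ

*-monoˡ-≤-0≤ : ∀ {r a b} → 0ℚ ≤ℚ r → a ≤ℚ b → r · a ≤ℚ r · b
*-monoˡ-≤-0≤ {r} 0≤r = ℚₚ.*-monoˡ-≤-nonNeg r {{nonNegative 0≤r}}

0≤* : ∀ {a b} → 0ℚ ≤ℚ a → 0ℚ ≤ℚ b → 0ℚ ≤ℚ a · b
0≤* {a} {b} 0≤a 0≤b =
  ℚₚ.nonNegative⁻¹ (a · b) {{ℚₚ.nonNeg*nonNeg⇒nonNeg a {{nonNegative 0≤a}} b {{nonNegative 0≤b}}}}

*≤1 : ∀ {a b} → 0ℚ ≤ℚ a → a ≤ℚ 1ℚ → b ≤ℚ 1ℚ → a · b ≤ℚ 1ℚ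
*≤1 {a} 0≤a a≤1 b≤1 =
  ℚₚ.≤-trans (*-monoˡ-≤-0≤ 0≤a b≤1) (ℚₚ.≤-trans (ℚₚ.≤-reflexive (ℚₚ.*-identityʳ a)) a≤1)

0≤1- : ∀ {x} → x ≤ℚ 1ℚ → 0ℚ ≤ℚ 1ℚ - x
0≤1- {x} x≤1 = ℚₚ.≤-trans (ℚₚ.≤-reflexive (sym (ℚₚ.+-inverseʳ x))) (ℚₚ.+-monoˡ-≤ (- x) x≤1)

1-≤1 : ∀ {x} → 0ℚ ≤ℚ x → 1ℚ - x ≤ℚ 1ℚ
1-≤1 0≤x = ℚₚ.+-monoʳ-≤ 1ℚ (ℚₚ.neg-antimono-≤ 0≤x)

x-y≤x : ∀ x {y} → 0ℚ ≤ℚ y → x - y ≤ℚ x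
x-y≤x x 0≤y = ℚₚ.≤-trans (ℚₚ.+-monoʳ-≤ x (ℚₚ.neg-antimono-≤ 0≤y)) (ℚₚ.≤-reflexive (ℚₚ.+-identityʳ x))

0≤^ : ∀ {x} k → 0ℚ ≤ℚ x → 0ℚ ≤ℚ x ^ℚ k
0≤^ zero    0≤x = 0≤1
0≤^ (suc k) 0≤x = 0≤* 0≤x (0≤^ k 0≤x)

^≤1 : ∀ {x} k → 0ℚ ≤ℚ x → x ≤ℚ 1ℚ → x ^ℚ k ≤ℚ 1ℚ
^≤1 zero    0≤x x≤1 = ℚₚ.≤-refl
^≤1 (suc k) 0≤x x≤1 = *≤1 0≤x x≤1 (^≤1 k 0≤x x≤1)

^-+ : ∀ x a b → x ^ℚ (a ℕ.+ b) ≡ x ^ℚ a · x ^ℚ b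
^-+ x zero    b = sym (ℚₚ.*-identityˡ (x ^ℚ b))
^-+ x (suc a) b = trans (cong (x ·_) (^-+ x a b)) (sym (ℚₚ.*-assoc x (x ^ℚ a) (x ^ℚ b)))

0≤indicator : ∀ {A : Set} (a? : Dec A) → 0ℚ ≤ℚ indicator a?
0≤indicator (yes _) = 0≤1
0≤indicator (no _)  = ℚₚ.≤-refl

indicator≤1 : ∀ {A : Set} (a? : Dec A) → indicator a? ≤ℚ 1ℚ
indicator≤1 (yes _) = ℚₚ.≤-refl
indicator≤1 (no _)  = 0≤1

indicator-yes : ∀ {A : Set} (a? : Dec A) → A → indicator a? ≡ 1ℚ
indicator-yes (yes _) _ = refl
indicator-yes (no ¬a) a = ⊥-elim (¬a a)

indicator-no : ∀ {A : Set} (a? : Dec A) → ¬ A → indicator a? ≡ 0ℚ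
indicator-no (yes a) ¬a = ⊥-elim (¬a a)
indicator-no (no _)  _  = refl

indicator-mono : ∀ {A B : Set} (a? : Dec A) (b? : Dec B) → (A → B) → indicator a? ≤ℚ indicator b?
indicator-mono (yes _) (yes _) _   = ℚₚ.≤-refl
indicator-mono (yes a) (no ¬b) A⇒B = ⊥-elim (¬b (A⇒B a))
indicator-mono (no _)  b?      _   = 0≤indicator b?

𝟙 : Bool → ℚ
𝟙 b = indicator (T? b)

1≤𝟙+[1-𝟙] : ∀ b c → (¬ T b → ¬ T c) → 1ℚ ≤ℚ 𝟙 b + (1ℚ - 𝟙 c)
1≤𝟙+[1-𝟙] true  true  _     = ℚₚ.≤-refl
1≤𝟙+[1-𝟙] true  false _     = ℚₚ.+-monoʳ-≤ 1ℚ 0≤1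
1≤𝟙+[1-𝟙] false true  ¬b⇒¬c = ⊥-elim (¬b⇒¬c (λ ()) tt)
1≤𝟙+[1-𝟙] false false _     = ℚₚ.≤-refl

-- Vertex sets

isEmpty : ∀ {n} → Subset n → Bool
isEmpty []      = true
isEmpty (b ∷ S) = not b ∧ isEmpty S

isSingleton : ∀ {n} → Subset n → Bool
isSingleton []          = false
isSingleton (true ∷ S)  = isEmpty S
isSingleton (false ∷ S) = isSingleton S

disjoint : ∀ {n} → Subset n → (Fin n → Bool) → Bool
disjoint []      A = true
disjoint (b ∷ S) A = not (b ∧ A zero) ∧ disjoint S (λ i → A (suc i))

size : ∀ {n} → (Fin n → Bool) → ℕ
size A = sum (λ i → b2n (A i))

¬isEmpty⇒Nonempty : ∀ {n} (S : Subset n) → ¬ T (isEmpty S) → Nonempty S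
¬isEmpty⇒Nonempty []          ¬empty = ⊥-elim (¬empty tt)
¬isEmpty⇒Nonempty (true ∷ S)  ¬empty = zero , here
¬isEmpty⇒Nonempty (false ∷ S) ¬empty = let i , i∈S = ¬isEmpty⇒Nonempty S ¬empty in suc i , there i∈S

isEmpty⇒∉ : ∀ {n} (S : Subset n) {i} → T (isEmpty S) → ¬ i ∈ S
isEmpty⇒∉ (false ∷ S) empty (there i∈S) = isEmpty⇒∉ S empty i∈S

disjoint⇒¬A : ∀ {n} (S : Subset n) A {i} → T (disjoint S A) → i ∈ S → ¬ T (A i)
disjoint⇒¬A (true ∷ S) A {zero} disj here with A zero
... | true  = ⊥-elim disj
... | false = λ ()
disjoint⇒¬A (b ∷ S) A {suc i} disj (there i∈S) =
  disjoint⇒¬A S (λ j → A (suc j)) (proj₂ (Equivalence.to (T-∧ {not (b ∧ A zero)}) disj)) i∈S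

isSingleton⇒Good : ∀ {n} (G : Digraph n) (S : Subset n) → T (isSingleton S) → Good G S
isSingleton⇒Good G S single =
  let j , j∈S , unique = element single in (j , j∈S) , λ u v u∈S v∈S → reach (unique u∈S) (unique v∈S)
  where
  element : ∀ {n} {S : Subset n} → T (isSingleton S) → ∃ λ j → j ∈ S × (∀ {x} → x ∈ S → x ≡ j)
  element {S = true ∷ S}  single =
    zero , here , λ { here → refl ; (there x∈S) → ⊥-elim (isEmpty⇒∉ S single x∈S) }
  element {S = false ∷ S} single =
    let j , j∈S , unique = element single in suc j , there j∈S , λ { (there x∈S) → cong suc (unique x∈S) }
  reach : ∀ {u v j} → u ≡ j → v ≡ j → Reach G S u v
  reach refl refl = here

centre-Good : ∀ {n} (S : Subset n) → Good (star (suc n)) (true ∷ S)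
centre-Good S = (zero , here) , connected
  where
  connected : StronglyConnectedOn (star _) (true ∷ S)
  connected zero    zero    _ _   = here
  connected zero    (suc j) _ j∈S = step refl j∈S here
  connected (suc i) zero    _ _   = step refl here here
  connected (suc i) (suc j) _ j∈S = step refl here (step refl j∈S here)

-- Deleting a vertex

delete : ∀ {n} → Fin (suc n) → Digraph (suc n) → Digraph n
delete v G = record
  { arc      = λ i j → arc G (punchIn v i) (punchIn v j)
  ; loopless = λ i → loopless G (punchIn v i)
  }

v∈insertAt : ∀ {n} (S : Subset n) v → v ∈ insertAt S v true
v∈insertAt S v = Vecₚ.lookup⇒[]= v _ (Vecₚ.insertAt-lookup S v true)

punchIn∈insertAt : ∀ {n} (S : Subset n) v b {i} → i ∈ S → punchIn v i ∈ insertAt S v b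
punchIn∈insertAt S v b {i} i∈S =
  Vecₚ.lookup⇒[]= _ _ (trans (Vecₚ.insertAt-punchIn S v b i) (Vecₚ.[]=⇒lookup i∈S))

∈insertAt⇒punchIn : ∀ {n} (S : Subset n) v b {x} → x ∈ insertAt S v b → v ≢ x →
  ∃ λ i → punchIn v i ≡ x × i ∈ S
∈insertAt⇒punchIn S v b {x} x∈ v≢x =
  punchOut v≢x , Finₚ.punchIn-punchOut v≢x , Vecₚ.lookup⇒[]= _ S (begin
    lookup S (punchOut v≢x)                            ≡⟨ Vecₚ.insertAt-punchIn S v b (punchOut v≢x) ⟨
    lookup (insertAt S v b) (punchIn v (punchOut v≢x)) ≡⟨ cong (lookup (insertAt S v b)) (Finₚ.punchIn-punchOut v≢x) ⟩
    lookup (insertAt S v b) x                          ≡⟨ Vecₚ.[]=⇒lookup x∈ ⟩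
    true                                               ∎)
  where open ≡-Reasoning

∈insertAt-false⇒punchIn : ∀ {n} (S : Subset n) v {x} → x ∈ insertAt S v false → ∃ λ i → punchIn v i ≡ x × i ∈ S
∈insertAt-false⇒punchIn S v x∈ = ∈insertAt⇒punchIn S v false x∈ v∉
  where
  v∉ : v ≢ _
  v∉ refl with trans (sym (Vecₚ.insertAt-lookup S v false)) (Vecₚ.[]=⇒lookup x∈)
  ... | ()

Good-delete : ∀ {n} (G : Digraph (suc n)) v S → Good G (insertAt S v false) → Good (delete v G) S
Good-delete G v S ((x , x∈) , connected) =
  (let i , _ , i∈S = ∈insertAt-false⇒punchIn S v x∈ in i , i∈S) ,
  λ i j i∈S j∈S → pull (connected _ _ (punchIn∈insertAt S v false i∈S) (punchIn∈insertAt S v false j∈S)) refl refl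
  where
  pull : ∀ {x y} → Reach G (insertAt S v false) x y →
    ∀ {i j} → punchIn v i ≡ x → punchIn v j ≡ y → Reach (delete v G) S i j
  pull here {i} {j} refl j≡ with Finₚ.punchIn-injective v i j (sym j≡)
  ... | refl = here
  pull (step x→z z∈ z⇝y) refl j≡ with ∈insertAt-false⇒punchIn S v z∈
  ... | k , refl , k∈S = step x→z k∈S (pull z⇝y refl j≡)

lastArc : ∀ {n} (G : Digraph n) T {u y} → Reach G T u y → u ∈ T → u ≢ y →
  ∃ λ x → x ∈ T × arc G x y ≡ true × x ≢ y
lastArc G T here u∈ u≢y = ⊥-elim (u≢y refl)
lastArc G T (step {v = z} {w = y} u→z z∈ z⇝y) u∈ u≢y with z Finₚ.≟ y
... | yes refl = _ , u∈ , u→z , u≢y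
... | no z≢y   = lastArc G T z⇝y z∈ z≢y

firstArc : ∀ {n} (G : Digraph n) T {u y} → Reach G T u y → u ≢ y → ∃ λ z → z ∈ T × arc G u z ≡ true
firstArc G T here              u≢y = ⊥-elim (u≢y refl)
firstArc G T (step u→z z∈ _) _ = _ , z∈ , u→z

Guard : ∀ {n} → Digraph (suc n) → Fin (suc n) → (Fin n → Bool) → Set
Guard G v A = ∀ S → Good G (insertAt S v true) → Nonempty S → ∃ λ i → i ∈ S × T (A i)

inNeighbours outNeighbours : ∀ {n} → Digraph (suc n) → Fin (suc n) → Fin n → Bool
inNeighbours  G v i = arc G (punchIn v i) v
outNeighbours G v i = arc G v (punchIn v i)

inNeighbours-guard : ∀ {n} (G : Digraph (suc n)) v → Guard G v (inNeighbours G v)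
inNeighbours-guard G v S (_ , connected) (j , j∈S)
  with lastArc G _ (connected _ v (punchIn∈insertAt S v true j∈S) (v∈insertAt S v))
                   (punchIn∈insertAt S v true j∈S) (Finₚ.punchInᵢ≢i v j)
... | x , x∈ , x→v , x≢v with ∈insertAt⇒punchIn S v true x∈ (λ v≡x → x≢v (sym v≡x))
... | i , refl , i∈S = i , i∈S , Equivalence.from T-≡ x→v

outNeighbours-guard : ∀ {n} (G : Digraph (suc n)) v → Guard G v (outNeighbours G v)
outNeighbours-guard G v S (_ , connected) (j , j∈S)
  with firstArc G _ (connected v _ (v∈insertAt S v) (punchIn∈insertAt S v true j∈S))
                    (λ v≡ → Finₚ.punchInᵢ≢i v j (sym v≡))
... | z , z∈ , v→z with ∈insertAt⇒punchIn S v true z∈ (λ { refl → no-loop v→z })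
  where
  no-loop : ¬ arc G v v ≡ true
  no-loop v→v with trans (sym (loopless G v)) v→v
  ... | ()
... | i , refl , i∈S = i , i∈S , Equivalence.from T-≡ v→z

-- Degrees

inDegree outDegree degree : ∀ {n} → Digraph n → Fin n → ℕ
inDegree  G v = sum (λ u → b2n (arc G u v))
outDegree G v = sum (λ w → b2n (arc G v w))
degree    G v = inDegree G v ℕ.+ outDegree G v

inDegree≡size : ∀ {n} (G : Digraph (suc n)) v → inDegree G v ≡ size (inNeighbours G v)
inDegree≡size G v = trans (sum-remove {i = v} (λ u → b2n (arc G u v)))
                          (cong (λ b → b2n b ℕ.+ size (inNeighbours G v)) (loopless G v))

outDegree≡size : ∀ {n} (G : Digraph (suc n)) v → outDegree G v ≡ size (outNeighbours G v)
outDegree≡size G v = trans (sum-remove {i = v} (λ w → b2n (arc G v w)))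
                           (cong (λ b → b2n b ℕ.+ size (outNeighbours G v)) (loopless G v))

countFin≡sum : ∀ {n} {f g : Fin n → ℕ} → (∀ i → f i ≡ g i) → countFin f ≡ sum g
countFin≡sum {zero}  f≗g = refl
countFin≡sum {suc n} f≗g = cong₂ ℕ._+_ (f≗g zero) (countFin≡sum (λ i → f≗g (suc i)))

numArcs≡sum-outDegree : ∀ {n} (G : Digraph n) → numArcs G ≡ sum (outDegree G)
numArcs≡sum-outDegree G = countFin≡sum (λ u → countFin≡sum {f = λ w → b2n (arc G u w)} (λ _ → refl))

handshake : ∀ {n} (G : Digraph n) → sum (degree G) ≡ numArcs G ℕ.+ numArcs G
handshake G = begin
  sum (degree G)                          ≡⟨ ∑-distrib-+ (inDegree G) (outDegree G) ⟩
  sum (inDegree G) ℕ.+ sum (outDegree G)  ≡⟨ cong (ℕ._+ sum (outDegree G)) (∑-comm (λ v u → b2n (arc G u v))) ⟩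
  sum (outDegree G) ℕ.+ sum (outDegree G) ≡⟨ cong₂ ℕ._+_ (sym (numArcs≡sum-outDegree G)) (sym (numArcs≡sum-outDegree G)) ⟩
  numArcs G ℕ.+ numArcs G                 ∎
  where open ≡-Reasoning

numArcs-delete : ∀ {n} (G : Digraph (suc n)) v → numArcs G ≡ degree G v ℕ.+ numArcs (delete v G)
numArcs-delete G v = begin
  numArcs G
    ≡⟨ numArcs≡sum-outDegree G ⟩
  sum (outDegree G)
    ≡⟨ sum-remove {i = v} (outDegree G) ⟩
  outDegree G v ℕ.+ sum (λ i → outDegree G (punchIn v i))
    ≡⟨ cong (outDegree G v ℕ.+_) (sum-cong-≗ (λ i → sum-remove {i = v} (λ w → b2n (arc G (punchIn v i) w)))) ⟩
  outDegree G v ℕ.+ sum (λ i → b2n (inNeighbours G v i) ℕ.+ outDegree (delete v G) i)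
    ≡⟨ cong (outDegree G v ℕ.+_) (∑-distrib-+ (λ i → b2n (inNeighbours G v i)) (outDegree (delete v G))) ⟩
  outDegree G v ℕ.+ (size (inNeighbours G v) ℕ.+ sum (outDegree (delete v G)))
    ≡⟨ cong₂ (λ a m → outDegree G v ℕ.+ (a ℕ.+ m)) (sym (inDegree≡size G v)) (sym (numArcs≡sum-outDegree (delete v G))) ⟩
  outDegree G v ℕ.+ (inDegree G v ℕ.+ numArcs (delete v G))
    ≡⟨ swap (outDegree G v) (inDegree G v) (numArcs (delete v G)) ⟩
  degree G v ℕ.+ numArcs (delete v G)
    ∎
  where
  open ≡-Reasoning
  swap : ∀ a b c → a ℕ.+ (b ℕ.+ c) ≡ (b ℕ.+ a) ℕ.+ c
  swap = ℕ-Solver.solve-∀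

sum-lowerBound : ∀ {n} k (f : Fin n → ℕ) → (∀ i → k ≤ f i) → n * k ≤ sum f
sum-lowerBound {zero}  k f k≤f = z≤n
sum-lowerBound {suc n} k f k≤f =
  ℕₚ.+-mono-≤ (k≤f zero) (sum-lowerBound k (λ i → f (suc i)) (λ i → k≤f (suc i)))

lowDegreeVertex : ∀ {n} (G : Digraph (suc (suc n))) d → numArcs G < 2 * (d ℕ.+ suc (suc n)) →
  ∃ λ v → degree G v < 2 * suc (suc d)
lowDegreeVertex {n} G d sparse with Finₚ.any? (λ v → degree G v ℕₚ.<? 2 * suc (suc d))
... | yes found = found
... | no  none  = ⊥-elim (ℕₚ.<⇒≱ (ℕₚ.+-mono-< sparse sparse) dense)
  where
  open ℕₚ.≤-Reasoning
  N = suc (suc n)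
  expand : ∀ n d → 2 * (d ℕ.+ (2 ℕ.+ n)) ℕ.+ 2 * (d ℕ.+ (2 ℕ.+ n)) ℕ.+ 2 * (n * d) ≡ (2 ℕ.+ n) * (2 * (2 ℕ.+ d))
  expand = ℕ-Solver.solve-∀
  dense : 2 * (d ℕ.+ N) ℕ.+ 2 * (d ℕ.+ N) ≤ numArcs G ℕ.+ numArcs G
  dense = begin
    2 * (d ℕ.+ N) ℕ.+ 2 * (d ℕ.+ N)                 ≤⟨ ℕₚ.m≤m+n _ (2 * (n * d)) ⟩
    2 * (d ℕ.+ N) ℕ.+ 2 * (d ℕ.+ N) ℕ.+ 2 * (n * d) ≡⟨ expand n d ⟩
    N * (2 * suc (suc d))                           ≤⟨ sum-lowerBound _ (degree G) (λ v → ℕₚ.≮⇒≥ (λ low → none (v , low))) ⟩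
    sum (degree G)                                  ≡⟨ handshake G ⟩
    numArcs G ℕ.+ numArcs G                         ∎

smallGuard : ∀ {n} (G : Digraph (suc n)) v → ∃ λ A → Guard G v A × 2 * size A ≤ degree G v
smallGuard G v with inDegree G v ℕₚ.≤? outDegree G v
... | yes in≤out = inNeighbours G v , inNeighbours-guard G v ,
  subst (λ a → 2 * a ≤ degree G v) (inDegree≡size G v)
        (ℕₚ.+-monoʳ-≤ (inDegree G v) (ℕₚ.≤-trans (ℕₚ.≤-reflexive (ℕₚ.+-identityʳ _)) in≤out))
... | no  in≰out = outNeighbours G v , outNeighbours-guard G v ,
  subst (λ b → 2 * b ≤ degree G v) (outDegree≡size G v)
        (ℕₚ.+-mono-≤ (ℕₚ.≰⇒≥ in≰out) (ℕₚ.≤-reflexive (ℕₚ.+-identityʳ _)))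

double≤<double⇒≤ : ∀ {s δ t} → 2 * s ≤ δ → δ < 2 * suc t → s ≤ t
double≤<double⇒≤ {s} {δ} {t} 2s≤δ δ<2t+2 =
  ℕₚ.≤-pred (ℕₚ.*-cancelˡ-< 2 s (suc t) (ℕₚ.≤-<-trans 2s≤δ δ<2t+2))

arcBudget-delete : ∀ {m m′ δ s d d′ N} → m ≡ δ ℕ.+ m′ → 2 * s ≤ δ → s ℕ.+ d′ ≡ suc d →
  m < 2 * (d ℕ.+ suc N) → m′ < 2 * (d′ ℕ.+ N)
arcBudget-delete {m} {m′} {δ} {s} {d} {d′} {N} refl 2s≤δ s+d′≡1+d sparse =
  ℕₚ.+-cancelˡ-< (2 * s) m′ (2 * (d′ ℕ.+ N)) (begin-strict
    2 * s ℕ.+ m′             ≤⟨ ℕₚ.+-monoˡ-≤ m′ 2s≤δ ⟩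
    δ ℕ.+ m′                 <⟨ sparse ⟩
    2 * (d ℕ.+ suc N)        ≡⟨ cong (2 *_) (ℕₚ.+-suc d N) ⟩
    2 * (suc d ℕ.+ N)        ≡⟨ cong (λ x → 2 * (x ℕ.+ N)) (sym s+d′≡1+d) ⟩
    2 * (s ℕ.+ d′ ℕ.+ N)     ≡⟨ distrib s d′ N ⟩
    2 * s ℕ.+ 2 * (d′ ℕ.+ N) ∎)
  where
  open ℕₚ.≤-Reasoning
  distrib : ∀ s d′ N → 2 * (s ℕ.+ d′ ℕ.+ N) ≡ 2 * s ℕ.+ 2 * (d′ ℕ.+ N)
  distrib = ℕ-Solver.solve-∀

-- Random vertex sets

listSum : List ℚ → ℚ
listSum = foldr _+_ 0ℚ

listSum-unique : {σ : List ℚ → ℚ} → σ [] ≡ 0ℚ → (∀ x xs → σ (x ∷ xs) ≡ x + σ xs) → ∀ xs → σ xs ≡ listSum xs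
listSum-unique σ[] σ∷ []       = σ[]
listSum-unique σ[] σ∷ (x ∷ xs) = trans (σ∷ x xs) (cong (x +_) (listSum-unique σ[] σ∷ xs))

listSum-++ : ∀ xs ys → listSum (xs ++ ys) ≡ listSum xs + listSum ys
listSum-++ []       ys = sym (ℚₚ.+-identityˡ _)
listSum-++ (x ∷ xs) ys = trans (cong (x +_) (listSum-++ xs ys)) (sym (ℚₚ.+-assoc x _ _))

listSum-map-scaled : ∀ {A B : Set} (h : A → B) (F : B → ℚ) (c : ℚ) (g : A → ℚ) →
  (∀ x → F (h x) ≡ c · g x) → ∀ xs → listSum (map F (map h xs)) ≡ c · listSum (map g xs)
listSum-map-scaled h F c g Fh≡cg []       = sym (ℚₚ.*-zeroʳ c)
listSum-map-scaled h F c g Fh≡cg (x ∷ xs) =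
  trans (cong₂ _+_ (Fh≡cg x) (listSum-map-scaled h F c g Fh≡cg xs)) (sym (ℚₚ.*-distribˡ-+ c _ _))

module Bernoulli (p : ℚ) where

  q : ℚ
  q = 1ℚ - p

  𝔼 : ∀ n → (Subset n → ℚ) → ℚ
  𝔼 zero    f = f []
  𝔼 (suc n) f = p · 𝔼 n (λ S → f (true ∷ S)) + q · 𝔼 n (λ S → f (false ∷ S))

  𝔼-cong : ∀ n {f g : Subset n → ℚ} → (∀ S → f S ≡ g S) → 𝔼 n f ≡ 𝔼 n g
  𝔼-cong zero    f≗g = f≗g []
  𝔼-cong (suc n) f≗g =
    cong₂ (λ a b → p · a + q · b) (𝔼-cong n (λ S → f≗g (true ∷ S))) (𝔼-cong n (λ S → f≗g (false ∷ S)))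

  𝔼-const : ∀ n c → 𝔼 n (λ _ → c) ≡ c
  𝔼-const zero    c = refl
  𝔼-const (suc n) c = trans (cong (λ a → p · a + q · a) (𝔼-const n c)) (affine p c)
    where
    affine : ∀ p c → p · c + (1ℚ - p) · c ≡ c
    affine = solve-∀ ℚ-ring

  𝔼-+ : ∀ n (f g : Subset n → ℚ) → 𝔼 n (λ S → f S + g S) ≡ 𝔼 n f + 𝔼 n g
  𝔼-+ zero    f g = refl
  𝔼-+ (suc n) f g =
    trans (cong₂ (λ a b → p · a + q · b) (𝔼-+ n (λ S → f (true ∷ S)) (λ S → g (true ∷ S)))
                                         (𝔼-+ n (λ S → f (false ∷ S)) (λ S → g (false ∷ S))))
          (regroup p q _ _ _ _)
    where
    regroup : ∀ p q a b c d → p · (a + b) + q · (c + d) ≡ (p · a + q · c) + (p · b + q · d)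
    regroup = solve-∀ ℚ-ring

  𝔼-1- : ∀ n (f : Subset n → ℚ) → 𝔼 n (λ S → 1ℚ - f S) ≡ 1ℚ - 𝔼 n f
  𝔼-1- zero    f = refl
  𝔼-1- (suc n) f =
    trans (cong₂ (λ a b → p · a + q · b) (𝔼-1- n (λ S → f (true ∷ S))) (𝔼-1- n (λ S → f (false ∷ S))))
          (complement p _ _)
    where
    complement : ∀ p a b → p · (1ℚ - a) + (1ℚ - p) · (1ℚ - b) ≡ 1ℚ - (p · a + (1ℚ - p) · b)
    complement = solve-∀ ℚ-ring

  𝔼-insertAt : ∀ n (v : Fin (suc n)) (f : Subset (suc n) → ℚ) →
    𝔼 (suc n) f ≡ p · 𝔼 n (λ S → f (insertAt S v true)) + q · 𝔼 n (λ S → f (insertAt S v false))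
  𝔼-insertAt n       zero    f = refl
  𝔼-insertAt (suc n) (suc v) f =
    trans (cong₂ (λ a b → p · a + q · b) (𝔼-insertAt n v (λ S → f (true ∷ S)))
                                         (𝔼-insertAt n v (λ S → f (false ∷ S))))
          (regroup p q _ _ _ _)
    where
    regroup : ∀ p q a b c d →
      p · (p · a + q · b) + q · (p · c + q · d) ≡ p · (p · a + q · c) + q · (p · b + q · d)
    regroup = solve-∀ ℚ-ring

  𝔼-isEmpty : ∀ n → 𝔼 n (λ S → 𝟙 (isEmpty S)) ≡ q ^ℚ n
  𝔼-isEmpty zero    = refl
  𝔼-isEmpty (suc n) =
    trans (cong₂ (λ a b → p · a + q · b) (𝔼-const n 0ℚ) (𝔼-isEmpty n)) (absent p q (q ^ℚ n))
    where
    absent : ∀ p q z → p · 0ℚ + q · z ≡ q · z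
    absent = solve-∀ ℚ-ring

  𝔼-disjoint : ∀ n (A : Fin n → Bool) → 𝔼 n (λ S → 𝟙 (disjoint S A)) ≡ q ^ℚ size A
  𝔼-disjoint zero    A = refl
  𝔼-disjoint (suc n) A with A zero
  ... | true  = trans (cong₂ (λ a b → p · a + q · b) (𝔼-const n 0ℚ) (𝔼-disjoint n (λ i → A (suc i))))
                      (absent p q _)
    where
    absent : ∀ p q z → p · 0ℚ + q · z ≡ q · z
    absent = solve-∀ ℚ-ring
  ... | false = trans (cong (λ a → p · a + q · a) (𝔼-disjoint n (λ i → A (suc i)))) (affine p _)
    where
    affine : ∀ p z → p · z + (1ℚ - p) · z ≡ z
    affine = solve-∀ ℚ-ring

  𝔼-isSingleton : ∀ n → 𝔼 (suc n) (λ S → 𝟙 (isSingleton S)) ≡ (suc n ×ℚ 1ℚ) · (p · q ^ℚ n)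
  𝔼-isSingleton zero    = base p
    where
    base : ∀ p → p · 1ℚ + (1ℚ - p) · 0ℚ ≡ (1ℚ + 0ℚ) · (p · 1ℚ)
    base = solve-∀ ℚ-ring
  𝔼-isSingleton (suc n) =
    trans (cong₂ (λ a b → p · a + q · b) (𝔼-isEmpty (suc n)) (𝔼-isSingleton n))
          (extend p q (q ^ℚ n) (suc n ×ℚ 1ℚ))
    where
    extend : ∀ p q z k → p · (q · z) + q · (k · (p · z)) ≡ (1ℚ + k) · (p · (q · z))
    extend = solve-∀ ℚ-ring

  weight : ∀ n → Subset n → ℚ
  weight n S = p ^ℚ ∣ S ∣ · q ^ℚ (n ∸ ∣ S ∣)

  listSum-weighted : ∀ n (f : Subset n → ℚ) → listSum (map (λ S → f S · weight n S) (allSubsets n)) ≡ 𝔼 n f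
  listSum-weighted zero    f = trans (ℚₚ.+-identityʳ _) (ℚₚ.*-identityʳ (f []))
  listSum-weighted (suc n) f = begin
    listSum (map F (map (true ∷_) Ss ++ map (false ∷_) Ss))
      ≡⟨ cong listSum (Listₚ.map-++ F (map (true ∷_) Ss) _) ⟩
    listSum (map F (map (true ∷_) Ss) ++ map F (map (false ∷_) Ss))
      ≡⟨ listSum-++ (map F (map (true ∷_) Ss)) _ ⟩
    listSum (map F (map (true ∷_) Ss)) + listSum (map F (map (false ∷_) Ss))
      ≡⟨ cong₂ _+_ (listSum-map-scaled (true ∷_) F p (λ S → f (true ∷ S) · weight n S) F-true Ss)
                   (listSum-map-scaled (false ∷_) F q (λ S → f (false ∷ S) · weight n S) F-false Ss) ⟩
    p · listSum (map (λ S → f (true ∷ S) · weight n S) Ss) + q · listSum (map (λ S → f (false ∷ S) · weight n S) Ss)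
      ≡⟨ cong₂ (λ a b → p · a + q · b) (listSum-weighted n (λ S → f (true ∷ S)))
                                       (listSum-weighted n (λ S → f (false ∷ S))) ⟩
    𝔼 (suc n) f
      ∎
    where
    open ≡-Reasoning
    Ss = allSubsets n
    F : Subset (suc n) → ℚ
    F S = f S · weight (suc n) S
    pull : ∀ r a b c → a · ((r · b) · c) ≡ r · (a · (b · c))
    pull = solve-∀ ℚ-ring
    pull′ : ∀ r a b c → a · (b · (r · c)) ≡ r · (a · (b · c))
    pull′ = solve-∀ ℚ-ring
    F-true : ∀ S → F (true ∷ S) ≡ p · (f (true ∷ S) · weight n S)
    F-true S = pull p (f (true ∷ S)) _ _
    F-false : ∀ S → F (false ∷ S) ≡ q · (f (false ∷ S) · weight n S)
    F-false S =
      trans (cong (λ k → f (false ∷ S) · (p ^ℚ ∣ S ∣ · q ^ℚ k)) (ℕₚ.+-∸-assoc 1 (Subsetₚ.∣p∣≤n S)))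
            (pull′ q (f (false ∷ S)) (p ^ℚ ∣ S ∣) (q ^ℚ (n ∸ ∣ S ∣)))

  -- Rel sums with a function local to its definition; abstracting the list of terms lets
  -- unification identify that function with σ in listSum-unique.
  Rel-as-listSum : ∀ {n} (G : Digraph n) dec →
    Rel G dec p ≡ listSum (map (λ S → indicator (dec S) · weight n S) (allSubsets n))
  Rel-as-listSum {n} G dec
    with map (λ S → indicator (dec S) · weight n S) (allSubsets n) | listSum-unique refl (λ _ _ → refl)
  ... | terms | sum≗listSum = sum≗listSum terms

  Rel≡𝔼 : ∀ {n} (G : Digraph n) dec → Rel G dec p ≡ 𝔼 n (λ S → indicator (dec S))
  Rel≡𝔼 {n} G dec = trans (Rel-as-listSum G dec) (listSum-weighted n _)

-- The reliability bound

module ReliabilityBound (p : ℚ) (0≤p : 0ℚ ≤ℚ p) (p≤1 : p ≤ℚ 1ℚ) where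
  open Bernoulli p

  0≤q : 0ℚ ≤ℚ q
  0≤q = 0≤1- p≤1

  q≤1 : q ≤ℚ 1ℚ
  q≤1 = 1-≤1 0≤p

  𝔼-mono : ∀ n {f g : Subset n → ℚ} → (∀ S → f S ≤ℚ g S) → 𝔼 n f ≤ℚ 𝔼 n g
  𝔼-mono zero    f≤g = f≤g []
  𝔼-mono (suc n) f≤g = ℚₚ.+-mono-≤ (*-monoˡ-≤-0≤ 0≤p (𝔼-mono n (λ S → f≤g (true ∷ S))))
                                   (*-monoˡ-≤-0≤ 0≤q (𝔼-mono n (λ S → f≤g (false ∷ S))))

  -- q ^ n is the probability that no vertex besides v is present, 1 - q ^ size A that A is met.
  𝔼-through : ∀ {n} (G : Digraph (suc n)) v {A} → Guard G v A →
    {P : Pred (Subset (suc n)) 0ℓ} (P? : Decidable P) → P ⊆ Good G →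
    𝔼 n (λ S → indicator (P? (insertAt S v true))) ≤ℚ q ^ℚ n + (1ℚ - q ^ℚ size A)
  𝔼-through {n} G v {A} guard P? P⊆Good = begin
    𝔼 n (λ S → indicator (P? (insertAt S v true)))
      ≤⟨ 𝔼-mono n pointwise ⟩
    𝔼 n (λ S → 𝟙 (isEmpty S) + (1ℚ - 𝟙 (disjoint S A)))
      ≡⟨ 𝔼-+ n (λ S → 𝟙 (isEmpty S)) (λ S → 1ℚ - 𝟙 (disjoint S A)) ⟩
    𝔼 n (λ S → 𝟙 (isEmpty S)) + 𝔼 n (λ S → 1ℚ - 𝟙 (disjoint S A))
      ≡⟨ cong₂ _+_ (𝔼-isEmpty n) (trans (𝔼-1- n (λ S → 𝟙 (disjoint S A))) (cong (λ x → 1ℚ - x) (𝔼-disjoint n A))) ⟩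
    q ^ℚ n + (1ℚ - q ^ℚ size A)
      ∎
    where
    open ℚₚ.≤-Reasoning
    pointwise : ∀ S → indicator (P? (insertAt S v true)) ≤ℚ 𝟙 (isEmpty S) + (1ℚ - 𝟙 (disjoint S A))
    pointwise S with P? (insertAt S v true)
    ... | no  _  = ℚₚ.+-mono-≤ (0≤indicator (T? (isEmpty S))) (0≤1- (indicator≤1 (T? (disjoint S A))))
    ... | yes PT = 1≤𝟙+[1-𝟙] (isEmpty S) (disjoint S A) λ nonempty avoids →
      let i , i∈S , Ai = guard S (P⊆Good PT) (¬isEmpty⇒Nonempty S nonempty) in disjoint⇒¬A S A avoids i∈S Ai

  -- X and W stand for the conditional reliabilities given that v is present, resp. absent.
  step-inequality : ∀ k {d d′ s X W} → s ℕ.+ d′ ≡ suc d →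
    X ≤ℚ q ^ℚ suc k + (1ℚ - q ^ℚ s) →
    q ^ℚ d′ · W ≤ℚ p + (k ×ℚ 1ℚ) · (p · q ^ℚ (d′ ℕ.+ k)) →
    q ^ℚ d · (p · X + q · W) ≤ℚ p + (suc k ×ℚ 1ℚ) · (p · q ^ℚ (d ℕ.+ suc k))
  step-inequality k {d} {d′} {s} {X} {W} s+d′≡1+d X≤ W≤ = begin
    Qd · (p · X + q · W)
      ≡⟨ expand Qd p q X W ⟩
    (Qd · p) · X + q ^ℚ suc d · W
      ≡⟨ cong (λ r → (Qd · p) · X + r · W) q^[1+d] ⟩
    (Qd · p) · X + (U · V) · W
      ≡⟨ cong ((Qd · p) · X +_) (ℚₚ.*-assoc U V W) ⟩
    (Qd · p) · X + U · (V · W)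
      ≤⟨ ℚₚ.+-mono-≤ (*-monoˡ-≤-0≤ (0≤* (0≤^ d 0≤q) 0≤p) X≤) (*-monoˡ-≤-0≤ (0≤^ s 0≤q) W≤) ⟩
    (Qd · p) · (q · Z + (1ℚ - U)) + U · (p + K · (p · q ^ℚ (d′ ℕ.+ k)))
      ≡⟨ cong (λ r → (Qd · p) · (q · Z + (1ℚ - U)) + U · (p + K · (p · r))) (^-+ q d′ k) ⟩
    (Qd · p) · (q · Z + (1ℚ - U)) + U · (p + K · (p · (V · Z)))
      ≡⟨ cong ((Qd · p) · (q · Z + (1ℚ - U)) +_) (regroup U V p K Z) ⟩
    (Qd · p) · (q · Z + (1ℚ - U)) + (U · p + K · (p · ((U · V) · Z)))
      ≡⟨ cong (λ r → (Qd · p) · (q · Z + (1ℚ - U)) + (U · p + K · (p · (r · Z)))) (sym q^[1+d]) ⟩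
    (Qd · p) · (q · Z + (1ℚ - U)) + (U · p + K · (p · ((q · Qd) · Z)))
      ≡⟨ collect Qd p q U K Z ⟩
    (p + (1ℚ + K) · (p · (Qd · (q · Z)))) - p · ((1ℚ - Qd) · (1ℚ - U))
      ≤⟨ x-y≤x _ (0≤* 0≤p (0≤* (0≤1- (^≤1 d 0≤q q≤1)) (0≤1- (^≤1 s 0≤q q≤1)))) ⟩
    p + (1ℚ + K) · (p · (Qd · (q · Z)))
      ≡⟨ cong (λ r → p + (1ℚ + K) · (p · r)) (^-+ q d (suc k)) ⟨
    p + (suc k ×ℚ 1ℚ) · (p · q ^ℚ (d ℕ.+ suc k))
      ∎
    where
    open ℚₚ.≤-Reasoning
    Qd = q ^ℚ d
    U  = q ^ℚ s
    V  = q ^ℚ d′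
    Z  = q ^ℚ k
    K  = k ×ℚ 1ℚ
    q^[1+d] : q ^ℚ suc d ≡ U · V
    q^[1+d] = trans (cong (q ^ℚ_) (sym s+d′≡1+d)) (^-+ q s d′)
    expand : ∀ Qd p q X W → Qd · (p · X + q · W) ≡ (Qd · p) · X + (q · Qd) · W
    expand = solve-∀ ℚ-ring
    regroup : ∀ U V p K Z → U · (p + K · (p · (V · Z))) ≡ U · p + K · (p · ((U · V) · Z))
    regroup = solve-∀ ℚ-ring
    collect : ∀ Qd p q U K Z →
      (Qd · p) · (q · Z + (1ℚ - U)) + (U · p + K · (p · ((q · Qd) · Z)))
        ≡ (p + (1ℚ + K) · (p · (Qd · (q · Z)))) - p · ((1ℚ - Qd) · (1ℚ - U))
    collect = solve-∀ ℚ-ring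

  -- For d = 0 the right-hand side is Rel(S_(n+1), p).
  sparse-bound : ∀ n (G : Digraph (suc n)) {P : Pred (Subset (suc n)) 0ℓ} (P? : Decidable P) → P ⊆ Good G →
    ∀ d → numArcs G < 2 * (d ℕ.+ suc n) →
    q ^ℚ d · 𝔼 (suc n) (λ S → indicator (P? S)) ≤ℚ p + (n ×ℚ 1ℚ) · (p · q ^ℚ (d ℕ.+ n))
  sparse-bound zero G P? P⊆Good d _ = begin
    q ^ℚ d · (p · indicator (P? (true ∷ [])) + q · indicator (P? (false ∷ [])))
      ≡⟨ cong (λ r → q ^ℚ d · (p · indicator (P? (true ∷ [])) + q · r))
              (indicator-no (P? (false ∷ [])) (λ P∅ → ∅-not-Good (P⊆Good P∅))) ⟩
    q ^ℚ d · (p · indicator (P? (true ∷ [])) + q · 0ℚ)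
      ≡⟨ only-present (q ^ℚ d) p q (indicator (P? (true ∷ []))) ⟩
    p · (q ^ℚ d · indicator (P? (true ∷ [])))
      ≤⟨ *-monoˡ-≤-0≤ 0≤p (*≤1 (0≤^ d 0≤q) (^≤1 d 0≤q q≤1) (indicator≤1 (P? (true ∷ [])))) ⟩
    p · 1ℚ
      ≡⟨ no-leaves p (p · q ^ℚ (d ℕ.+ 0)) ⟩
    p + 0ℚ · (p · q ^ℚ (d ℕ.+ 0))
      ∎
    where
    open ℚₚ.≤-Reasoning
    ∅-not-Good : ¬ Good G (false ∷ [])
    ∅-not-Good ((zero , ()) , _)
    only-present : ∀ a p q h → a · (p · h + q · 0ℚ) ≡ p · (a · h)
    only-present = solve-∀ ℚ-ring
    no-leaves : ∀ p r → p · 1ℚ ≡ p + 0ℚ · r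
    no-leaves = solve-∀ ℚ-ring
  sparse-bound (suc k) G P? P⊆Good d sparse with lowDegreeVertex G d sparse
  ... | v , low with smallGuard G v
  ... | A , guard , 2s≤δ with ℕₚ.m≤n⇒∃[o]m+o≡n (double≤<double⇒≤ 2s≤δ low)
  ... | d′ , s+d′≡1+d = begin
    q ^ℚ d · 𝔼 (suc (suc k)) (λ S → indicator (P? S))
      ≡⟨ cong (q ^ℚ d ·_) (𝔼-insertAt (suc k) v (λ S → indicator (P? S))) ⟩
    q ^ℚ d · (p · 𝔼 (suc k) (λ S → indicator (P? (insertAt S v true)))
              + q · 𝔼 (suc k) (λ S → indicator (P? (insertAt S v false))))
      ≤⟨ step-inequality k {s = size A} s+d′≡1+d (𝔼-through G v guard P? P⊆Good) rest-bound ⟩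
    p + (suc k ×ℚ 1ℚ) · (p · q ^ℚ (d ℕ.+ suc k))
      ∎
    where
    open ℚₚ.≤-Reasoning
    rest-bound : q ^ℚ d′ · 𝔼 (suc k) (λ S → indicator (P? (insertAt S v false)))
                   ≤ℚ p + (k ×ℚ 1ℚ) · (p · q ^ℚ (d′ ℕ.+ k))
    rest-bound = sparse-bound k (delete v G) (λ S → P? (insertAt S v false))
                              (λ {S} PS → Good-delete G v S (P⊆Good PS))
                              d′ (arcBudget-delete {s = size A} (numArcs-delete G v) 2s≤δ s+d′≡1+d sparse)

  star-bound : ∀ n (P? : Decidable (Good (star (suc (suc n))))) →
    p + (suc n ×ℚ 1ℚ) · (p · q ^ℚ suc n) ≤ℚ 𝔼 (suc (suc n)) (λ S → indicator (P? S))
  star-bound n P? = begin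
    p + (suc n ×ℚ 1ℚ) · (p · q ^ℚ suc n)
      ≡⟨ shift p q (suc n ×ℚ 1ℚ) (q ^ℚ n) ⟩
    p · 1ℚ + q · ((suc n ×ℚ 1ℚ) · (p · q ^ℚ n))
      ≡⟨ cong₂ (λ a b → p · a + q · b) (sym centre-present) (sym (𝔼-isSingleton n)) ⟩
    p · 𝔼 (suc n) (λ S → indicator (P? (true ∷ S))) + q · 𝔼 (suc n) (λ S → 𝟙 (isSingleton S))
      ≤⟨ ℚₚ.+-monoʳ-≤ (p · 𝔼 (suc n) (λ S → indicator (P? (true ∷ S))))
                      (*-monoˡ-≤-0≤ 0≤q (𝔼-mono (suc n) singletons-Good)) ⟩
    𝔼 (suc (suc n)) (λ S → indicator (P? S))
      ∎
    where
    open ℚₚ.≤-Reasoning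
    shift : ∀ p q K Z → p + K · (p · (q · Z)) ≡ p · 1ℚ + q · (K · (p · Z))
    shift = solve-∀ ℚ-ring
    centre-present : 𝔼 (suc n) (λ S → indicator (P? (true ∷ S))) ≡ 1ℚ
    centre-present =
      trans (𝔼-cong (suc n) (λ S → indicator-yes (P? (true ∷ S)) (centre-Good S))) (𝔼-const (suc n) 1ℚ)
    singletons-Good : ∀ S → 𝟙 (isSingleton S) ≤ℚ indicator (P? (false ∷ S))
    singletons-Good S =
      indicator-mono (T? (isSingleton S)) (P? (false ∷ S)) (isSingleton⇒Good (star _) (false ∷ S))

mainTheorem3 : (n : ℕ) → 3 ≤ n → (G : Digraph n) → StronglyConnected G →
    numArcs G ≡ 2 * n ∸ 2 →
    (decG : ∀ S → Dec (Good G S)) → (decS : ∀ S → Dec (Good (star n) S)) →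
    (p : ℚ) → 0ℚ ≤ℚ p → p ≤ℚ 1ℚ →
    Rel G decG p ≤ℚ Rel (star n) decS p
mainTheorem3 n@(suc (suc (suc j))) (s≤s (s≤s (s≤s _))) G _ arcs decG decS p 0≤p p≤1 = begin
  Rel G decG p                                     ≡⟨ Rel≡𝔼 G decG ⟩
  𝔼 n (λ S → indicator (decG S))                   ≡⟨ ℚₚ.*-identityˡ _ ⟨
  1ℚ · 𝔼 n (λ S → indicator (decG S))              ≤⟨ sparse-bound (suc (suc j)) G decG (λ good → good) 0 sparse ⟩
  p + (suc (suc j) ×ℚ 1ℚ) · (p · q ^ℚ suc (suc j)) ≤⟨ star-bound (suc j) decS ⟩
  𝔼 n (λ S → indicator (decS S))                   ≡⟨ Rel≡𝔼 (star n) decS ⟨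
  Rel (star n) decS p                              ∎
  where
  open Bernoulli p
  open ReliabilityBound p 0≤p p≤1
  open ℚₚ.≤-Reasoning
  sparse : numArcs G < 2 * n
  sparse = subst (_< 2 * n) (sym arcs) (ℕₚ.∸-monoʳ-< {o = 0} z<s (s≤s (s≤s z≤n)))
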